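{- Let $k\ge1$. Then $$\sum_{n\ge0}k^{n+1}\frac{\Gamma(n+1+\frac1k)}{\Gamma(\frac1k)}\,t^n=G_0,$$ where $(G_i)_{i\ge0}$ is the unique family of formal power series in $t$ with constant term $1$ satisfying $$G_i=\Bigg(1-(k+1)(i+1)t-\sum_{\ell=1}^{k}\binom{k+1}{\ell+1}\Big(\prod_{m=0}^{\ell}(i+m+1)\Big)t^{\ell+1}\prod_{m=1}^{\ell}G_{i+m}\Bigg)^{ -1},\qquad i\ge0.$$ In particular, for $k=2$ this gives a continued-fraction-type expansion of $\sum_{n\ge0}(2n+1)!!\,t^n=1+3t+15t^2+105t^3+945t^4+\cdots$.
   Context: For a formal power series $w$ in $t$ with zero constant term, $(1-w)^{ -1}=\sum_{m\ge0}w^m$. Note $k^{n+1}\Gamma(n+1+1/k)/\Gamma(1/k)=\prod_{i=1}^{n}(ki+1)$, the number of $k$-Stirling permutations of size $n+1$. -}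

module Defs where

open import Data.Nat as ℕ using (ℕ; zero; suc; _∸_)
open import Data.Nat.Combinatorics using (_C_)
open import Data.Integer using (ℤ; +_; _+_; _*_; _-_; -_)
open import Data.Product using (_×_)
open import Relation.Binary.PropositionalEquality using (_≡_)
open import Relation.Nullary using (yes; no)

FPS : Set
FPS = ℕ → ℤ

sumℤ : ℕ → (ℕ → ℤ) → ℤ
sumℤ zero    f = + 0
sumℤ (suc n) f = sumℤ n f + f n

prodℕ : ℕ → (ℕ → ℕ) → ℕ
prodℕ zero    f = 1
prodℕ (suc n) f = prodℕ n f ℕ.* f n

oneS : FPS
oneS zero    = + 1
oneS (suc n) = + 0

addS : FPS → FPS → FPS
addS f g n = f n + g n

subS : FPS → FPS → FPS
subS f g n = f n - g n

scaleS : ℤ → FPS → FPS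
scaleS c f n = c * f n

mulS : FPS → FPS → FPS
mulS f g n = sumℤ (suc n) (λ j → f j * g (n ∸ j))

tPow : ℕ → FPS
tPow p n with p ℕ.≟ n
... | yes _ = + 1
... | no  _ = + 0

powS : FPS → ℕ → FPS
powS w zero    = oneS
powS w (suc m) = mulS (powS w m) w

prodS : ℕ → (ℕ → FPS) → FPS
prodS zero    F = oneS
prodS (suc l) F = mulS (prodS l F) (F l)

sumS : ℕ → (ℕ → FPS) → FPS
sumS zero    F _ = + 0
sumS (suc l) F n = sumS l F n + F l n

-- (1 - w)^{-1} = Σ_{m ≥ 0} w^m, for w with zero constant term;
-- its n-th coefficient only involves m ≤ n.
geomInv : FPS → FPS
geomInv w n = sumℤ (suc n) (λ m → powS w m n)

-- The series w_i with  G_i = (1 - w_i)^{-1}: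
--   w_i = (k+1)(i+1) t
--       + Σ_{ℓ=1}^{k} C(k+1,ℓ+1) (Π_{m=0}^{ℓ} (i+m+1)) t^{ℓ+1} Π_{m=1}^{ℓ} G_{i+m}
wSeries : ℕ → (ℕ → FPS) → ℕ → FPS
wSeries k G i =
  addS (scaleS (+ ((suc k) ℕ.* (suc i))) (tPow 1))
       (sumS k (λ j → term (suc j)))
  where
  term : ℕ → FPS
  term ℓ = scaleS (+ ((suc k C suc ℓ) ℕ.* prodℕ (suc ℓ) (λ m → i ℕ.+ m ℕ.+ 1)))
                  (mulS (tPow (suc ℓ)) (prodS ℓ (λ m → G (i ℕ.+ suc m))))

IsSolution : ℕ → (ℕ → FPS) → Set
IsSolution k G = (i : ℕ) → (G i 0 ≡ + 1) × ((n : ℕ) → G i n ≡ geomInv (wSeries k G i) n)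

-- k^{n+1} Γ(n+1+1/k)/Γ(1/k) = Π_{i=1}^{n} (k i + 1)
kStirling : ℕ → ℕ → ℕ
kStirling k n = prodℕ n (λ j → k ℕ.* suc j ℕ.+ 1)

module Submission where

-- Existence and uniqueness: degree ≤ N+1 of w_i only sees degrees ≤ N of the
-- G_j (each G_j in w_i carries at least t^2), so solutions agree degree by
-- degree, and iterating the recursion from the constant family 1 stabilises;
-- its diagonal is a solution.
--
-- Value of G_0: with P_i = G_0 ⋯ G_{i-1} and a_i = i! P_{i+1}, the relations
-- G_i = 1 + G_i w_i give  a_i = i a_{i-1} + Σ_{ℓ≤k} C(k+1,ℓ+1)(ℓ+i+1) t^{ℓ+1} a_{ℓ+i}
-- (with a_{-1}-term P_0 = 1).  Hence [t^n] a_i = T(n+i, i) for the integer table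
-- T(N+1, j) = Σ_d C(k+1,d)(d+j) T(N, d+j-1).  Its binomial transform
-- W(n,m) = Σ_j C(m,j) T(n,j) obeys W(n+1,m) = (m+k+1) W(n,m+k) by Vandermonde and
-- absorption, so [t^n] G_0 = T(n,0) = W(n,0) = Π_{r<n} (k(r+1)+1).  (The argument
-- does not need k ≥ 1.)

open import Defs
open import Data.Nat using (ℕ; _≤_)
open import Data.Integer using (+_)
open import Data.Product using (Σ; _×_)
open import Relation.Binary.PropositionalEquality using (_≡_)

open import Data.Nat as ℕ using (zero; suc; _∸_; _<_; z≤n; s≤s; pred; _!)
import Data.Nat.Properties as ℕP
import Data.Nat.Tactic.RingSolver as ℕSolver
open import Data.Nat.Combinatorics using (_C_; nCk+nC[k+1]≡[n+1]C[k+1]; k>n⇒nCk≡0; nC1≡n)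
open import Data.Integer using (ℤ; _+_; _*_; 0ℤ; 1ℤ)
import Data.Integer.Properties as ℤP
open import Data.Integer.Tactic.RingSolver using (solve-∀)
open import Data.Product using (_,_; proj₁; proj₂)
open import Data.Sum using (inj₁; inj₂)
open import Data.Empty using (⊥-elim)
open import Function using (_∘_)
open import Relation.Binary.PropositionalEquality
  using (refl; sym; trans; cong; cong₂; subst; module ≡-Reasoning)
open import Relation.Nullary using (yes; no; ¬_)

open ≡-Reasoning

-- Finite sums of integers

sum-cong : ∀ n {f g : ℕ → ℤ} → (∀ j → j < n → f j ≡ g j) → sumℤ n f ≡ sumℤ n g
sum-cong zero    h = refl
sum-cong (suc n) h = cong₂ _+_ (sum-cong n (λ j j<n → h j (ℕP.m<n⇒m<1+n j<n))) (h n (ℕP.n<1+n n))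

sum-cong′ : ∀ n {f g : ℕ → ℤ} → (∀ j → f j ≡ g j) → sumℤ n f ≡ sumℤ n g
sum-cong′ n h = sum-cong n (λ j _ → h j)

sum-zero : ∀ n {f : ℕ → ℤ} → (∀ j → j < n → f j ≡ 0ℤ) → sumℤ n f ≡ 0ℤ
sum-zero zero    h = refl
sum-zero (suc n) h = cong₂ _+_ (sum-zero n (λ j j<n → h j (ℕP.m<n⇒m<1+n j<n))) (h n (ℕP.n<1+n n))

sum-+ : ∀ n (f g : ℕ → ℤ) → sumℤ n (λ j → f j + g j) ≡ sumℤ n f + sumℤ n g
sum-+ zero    f g = refl
sum-+ (suc n) f g =
  trans (cong (_+ (f n + g n)) (sum-+ n f g)) (interchange (sumℤ n f) (sumℤ n g) (f n) (g n))
  where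
  interchange : ∀ a b c d → (a + b) + (c + d) ≡ (a + c) + (b + d)
  interchange = solve-∀

sum-*ˡ : ∀ n c (f : ℕ → ℤ) → c * sumℤ n f ≡ sumℤ n (λ j → c * f j)
sum-*ˡ zero    c f = ℤP.*-zeroʳ c
sum-*ˡ (suc n) c f = trans (ℤP.*-distribˡ-+ c (sumℤ n f) (f n)) (cong (_+ c * f n) (sum-*ˡ n c f))

sum-*ʳ : ∀ n c (f : ℕ → ℤ) → sumℤ n f * c ≡ sumℤ n (λ j → f j * c)
sum-*ʳ n c f =
  trans (ℤP.*-comm (sumℤ n f) c) (trans (sum-*ˡ n c f) (sum-cong′ n (λ j → ℤP.*-comm c (f j))))

sum-head : ∀ n (f : ℕ → ℤ) → sumℤ (suc n) f ≡ f 0 + sumℤ n (f ∘ suc)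
sum-head zero    f = ℤP.+-comm 0ℤ (f 0)
sum-head (suc n) f = trans (cong (_+ f (suc n)) (sum-head n f)) (ℤP.+-assoc (f 0) _ _)

sum-swap : ∀ a b (f : ℕ → ℕ → ℤ) →
  sumℤ a (λ i → sumℤ b (f i)) ≡ sumℤ b (λ j → sumℤ a (λ i → f i j))
sum-swap zero    b f = sym (sum-zero b (λ _ _ → refl))
sum-swap (suc a) b f = begin
  sumℤ a (λ i → sumℤ b (f i)) + sumℤ b (f a)         ≡⟨ cong (_+ sumℤ b (f a)) (sum-swap a b f) ⟩
  sumℤ b (λ j → sumℤ a (λ i → f i j)) + sumℤ b (f a) ≡⟨ sym (sum-+ b _ _) ⟩
  sumℤ b (λ j → sumℤ (suc a) (λ i → f i j))          ∎

sum-pad : ∀ n c {f : ℕ → ℤ} → (∀ j → n ≤ j → f j ≡ 0ℤ) → sumℤ (c ℕ.+ n) f ≡ sumℤ n f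
sum-pad n zero    h = refl
sum-pad n (suc c) h =
  trans (cong₂ _+_ (sum-pad n c h) (h (c ℕ.+ n) (ℕP.m≤n+m n c))) (ℤP.+-identityʳ _)

sum-reverse : ∀ n (f : ℕ → ℤ) → sumℤ n f ≡ sumℤ n (λ j → f (n ∸ suc j))
sum-reverse zero    f = refl
sum-reverse (suc n) f = begin
  sumℤ n f + f n                          ≡⟨ cong (_+ f n) (sum-reverse n f) ⟩
  sumℤ n (λ j → f (n ∸ suc j)) + f n      ≡⟨ ℤP.+-comm _ (f n) ⟩
  f n + sumℤ n (λ j → f (n ∸ suc j))      ≡⟨ sym (sum-head n (λ j → f (suc n ∸ suc j))) ⟩
  sumℤ (suc n) (λ j → f (suc n ∸ suc j))  ∎

sum-triangle : ∀ n (A : ℕ → ℕ → ℤ) →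
  sumℤ n (λ j → sumℤ (suc j) (λ i → A i j)) ≡ sumℤ n (λ i → sumℤ (n ∸ i) (λ l → A i (i ℕ.+ l)))
sum-triangle zero    A = refl
sum-triangle (suc n) A = begin
  sumℤ n (λ j → sumℤ (suc j) (λ i → A i j)) + (sumℤ n (λ i → A i n) + A n n)
    ≡⟨ cong (_+ (sumℤ n (λ i → A i n) + A n n)) (sum-triangle n A) ⟩
  Rect + (sumℤ n (λ i → A i n) + A n n)
    ≡⟨ sym (ℤP.+-assoc Rect _ _) ⟩
  (Rect + sumℤ n (λ i → A i n)) + A n n
    ≡⟨ cong₂ _+_ (trans (sym (sum-+ n _ _)) (sum-cong n extendRow)) lastRow ⟩
  sumℤ n (λ i → sumℤ (suc n ∸ i) (λ l → A i (i ℕ.+ l))) + sumℤ (suc n ∸ n) (λ l → A n (n ℕ.+ l))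
    ∎
  where
  Rect : ℤ
  Rect = sumℤ n (λ i → sumℤ (n ∸ i) (λ l → A i (i ℕ.+ l)))
  -- row i < n gains the term l = n - i
  extendRow : ∀ i → i < n →
    sumℤ (n ∸ i) (λ l → A i (i ℕ.+ l)) + A i n ≡ sumℤ (suc n ∸ i) (λ l → A i (i ℕ.+ l))
  extendRow i i<n = begin
    sumℤ (n ∸ i) (λ l → A i (i ℕ.+ l)) + A i n
      ≡⟨ cong (λ x → sumℤ (n ∸ i) (λ l → A i (i ℕ.+ l)) + A i x) (sym (ℕP.m+[n∸m]≡n (ℕP.<⇒≤ i<n))) ⟩
    sumℤ (suc (n ∸ i)) (λ l → A i (i ℕ.+ l))
      ≡⟨ cong (λ x → sumℤ x (λ l → A i (i ℕ.+ l))) (sym (ℕP.+-∸-assoc 1 (ℕP.<⇒≤ i<n))) ⟩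
    sumℤ (suc n ∸ i) (λ l → A i (i ℕ.+ l)) ∎
  -- the new row i = n has the single term l = 0
  lastRow : A n n ≡ sumℤ (suc n ∸ n) (λ l → A n (n ℕ.+ l))
  lastRow = begin
    A n n                             ≡⟨ cong (A n) (sym (ℕP.+-identityʳ n)) ⟩
    A n (n ℕ.+ 0)                     ≡⟨ sym (ℤP.+-identityˡ _) ⟩
    sumℤ 1 (λ l → A n (n ℕ.+ l))      ≡⟨ cong (λ x → sumℤ x (λ l → A n (n ℕ.+ l))) (sym (ℕP.m+n∸n≡m 1 n)) ⟩
    sumℤ (suc n ∸ n) (λ l → A n (n ℕ.+ l)) ∎

-- The algebra of formal power series

infix 4 _≈S_
_≈S_ : FPS → FPS → Set
f ≈S g = ∀ n → f n ≡ g n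

AgreeUpTo : ℕ → FPS → FPS → Set
AgreeUpTo N f g = ∀ m → m ≤ N → f m ≡ g m

mulS-agree : ∀ N {f f′ g g′} → AgreeUpTo N f f′ → AgreeUpTo N g g′ →
  AgreeUpTo N (mulS f g) (mulS f′ g′)
mulS-agree N hf hg m m≤N = sum-cong (suc m) (λ j j<1+m →
  cong₂ _*_ (hf j (ℕP.≤-trans (ℕP.≤-pred j<1+m) m≤N)) (hg (m ∸ j) (ℕP.≤-trans (ℕP.m∸n≤m m j) m≤N)))

mulS-cong : ∀ {f f′ g g′} → f ≈S f′ → g ≈S g′ → mulS f g ≈S mulS f′ g′
mulS-cong hf hg n = mulS-agree n (λ m _ → hf m) (λ m _ → hg m) n ℕP.≤-refl

sumS-agree : ∀ N l {F F′ : ℕ → FPS} → (∀ j → AgreeUpTo N (F j) (F′ j)) →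
  AgreeUpTo N (sumS l F) (sumS l F′)
sumS-agree N zero    h m _   = refl
sumS-agree N (suc l) h m m≤N = cong₂ _+_ (sumS-agree N l h m m≤N) (h l m m≤N)

sumS-cong : ∀ l {F F′ : ℕ → FPS} → (∀ j → F j ≈S F′ j) → sumS l F ≈S sumS l F′
sumS-cong l h n = sumS-agree n l (λ j m _ → h j m) n ℕP.≤-refl

prodS-agree : ∀ N l {F F′ : ℕ → FPS} → (∀ j → AgreeUpTo N (F j) (F′ j)) →
  AgreeUpTo N (prodS l F) (prodS l F′)
prodS-agree N zero    h m _ = refl
prodS-agree N (suc l) h     = mulS-agree N (prodS-agree N l h) (h l)

prodS-cong : ∀ l {F F′ : ℕ → FPS} → (∀ j → F j ≈S F′ j) → prodS l F ≈S prodS l F′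
prodS-cong l h n = prodS-agree n l (λ j m _ → h j m) n ℕP.≤-refl

sumS-coeff : ∀ l (F : ℕ → FPS) n → sumS l F n ≡ sumℤ l (λ j → F j n)
sumS-coeff zero    F n = refl
sumS-coeff (suc l) F n = cong (_+ F l n) (sumS-coeff l F n)

mulS-comm : ∀ f g → mulS f g ≈S mulS g f
mulS-comm f g n = begin
  sumℤ (suc n) (λ j → f j * g (n ∸ j))               ≡⟨ sum-reverse (suc n) _ ⟩
  sumℤ (suc n) (λ j → f (n ∸ j) * g (n ∸ (n ∸ j)))   ≡⟨ sum-cong (suc n) swapFactors ⟩
  sumℤ (suc n) (λ j → g j * f (n ∸ j))               ∎
  where
  swapFactors : ∀ j → j < suc n → f (n ∸ j) * g (n ∸ (n ∸ j)) ≡ g j * f (n ∸ j)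
  swapFactors j j<1+n = trans (cong (λ x → f (n ∸ j) * g x) (ℕP.m∸[m∸n]≡n (ℕP.≤-pred j<1+n)))
                              (ℤP.*-comm (f (n ∸ j)) (g j))

mulS-assoc : ∀ f g h → mulS (mulS f g) h ≈S mulS f (mulS g h)
mulS-assoc f g h n = begin
  sumℤ (suc n) (λ j → sumℤ (suc j) (λ i → f i * g (j ∸ i)) * h (n ∸ j))
    ≡⟨ sum-cong′ (suc n) (λ j → sum-*ʳ (suc j) (h (n ∸ j)) _) ⟩
  sumℤ (suc n) (λ j → sumℤ (suc j) (λ i → f i * g (j ∸ i) * h (n ∸ j)))
    ≡⟨ sum-triangle (suc n) (λ i j → f i * g (j ∸ i) * h (n ∸ j)) ⟩
  sumℤ (suc n) (λ i → sumℤ (suc n ∸ i) (λ l → f i * g (i ℕ.+ l ∸ i) * h (n ∸ (i ℕ.+ l))))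
    ≡⟨ sum-cong (suc n) inner ⟩
  sumℤ (suc n) (λ i → f i * sumℤ (suc (n ∸ i)) (λ l → g l * h (n ∸ i ∸ l))) ∎
  where
  inner : ∀ i → i < suc n →
    sumℤ (suc n ∸ i) (λ l → f i * g (i ℕ.+ l ∸ i) * h (n ∸ (i ℕ.+ l)))
      ≡ f i * sumℤ (suc (n ∸ i)) (λ l → g l * h (n ∸ i ∸ l))
  inner i i<1+n = begin
    sumℤ (suc n ∸ i) (λ l → f i * g (i ℕ.+ l ∸ i) * h (n ∸ (i ℕ.+ l)))
      ≡⟨ cong (λ x → sumℤ x (λ l → f i * g (i ℕ.+ l ∸ i) * h (n ∸ (i ℕ.+ l))))
              (ℕP.+-∸-assoc 1 (ℕP.≤-pred i<1+n)) ⟩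
    sumℤ (suc (n ∸ i)) (λ l → f i * g (i ℕ.+ l ∸ i) * h (n ∸ (i ℕ.+ l)))
      ≡⟨ sum-cong′ (suc (n ∸ i)) (λ l → trans (ℤP.*-assoc (f i) _ _)
           (cong₂ (λ a b → f i * (g a * h b)) (ℕP.m+n∸m≡n i l) (sym (ℕP.∸-+-assoc n i l)))) ⟩
    sumℤ (suc (n ∸ i)) (λ l → f i * (g l * h (n ∸ i ∸ l)))
      ≡⟨ sym (sum-*ˡ (suc (n ∸ i)) (f i) _) ⟩
    f i * sumℤ (suc (n ∸ i)) (λ l → g l * h (n ∸ i ∸ l)) ∎

mulS-oneˡ : ∀ f → mulS oneS f ≈S f
mulS-oneˡ f n = begin
  sumℤ (suc n) (λ j → oneS j * f (n ∸ j))        ≡⟨ sum-head n _ ⟩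
  1ℤ * f n + sumℤ n (λ j → 0ℤ * f (n ∸ suc j))   ≡⟨ cong₂ _+_ (ℤP.*-identityˡ (f n)) (sum-zero n (λ _ _ → refl)) ⟩
  f n + 0ℤ                                       ≡⟨ ℤP.+-identityʳ (f n) ⟩
  f n                                            ∎

mulS-oneʳ : ∀ f → mulS f oneS ≈S f
mulS-oneʳ f n = trans (mulS-comm f oneS n) (mulS-oneˡ f n)

mulS-addˡ : ∀ f g h → mulS (addS f g) h ≈S addS (mulS f h) (mulS g h)
mulS-addˡ f g h n =
  trans (sum-cong′ (suc n) (λ j → ℤP.*-distribʳ-+ (h (n ∸ j)) (f j) (g j))) (sum-+ (suc n) _ _)

mulS-addʳ : ∀ f g h → mulS f (addS g h) ≈S addS (mulS f g) (mulS f h)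
mulS-addʳ f g h n = begin
  mulS f (addS g h) n             ≡⟨ mulS-comm f (addS g h) n ⟩
  mulS (addS g h) f n             ≡⟨ mulS-addˡ g h f n ⟩
  mulS g f n + mulS h f n         ≡⟨ cong₂ _+_ (mulS-comm g f n) (mulS-comm h f n) ⟩
  mulS f g n + mulS f h n         ∎

mulS-scaleˡ : ∀ c f h → mulS (scaleS c f) h ≈S scaleS c (mulS f h)
mulS-scaleˡ c f h n =
  trans (sum-cong′ (suc n) (λ j → ℤP.*-assoc c (f j) (h (n ∸ j)))) (sym (sum-*ˡ (suc n) c _))

mulS-sumˡ : ∀ l F h → mulS (sumS l F) h ≈S sumS l (λ j → mulS (F j) h)
mulS-sumˡ zero    F h n = sum-zero (suc n) (λ _ _ → refl)
mulS-sumˡ (suc l) F h n =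
  trans (mulS-addˡ (sumS l F) (F l) h n) (cong (_+ mulS (F l) h n) (mulS-sumˡ l F h n))

prodS-split : ∀ (F : ℕ → FPS) a l → prodS (a ℕ.+ l) F ≈S mulS (prodS a F) (prodS l (λ m → F (a ℕ.+ m)))
prodS-split F a zero n =
  trans (cong (λ x → prodS x F n) (ℕP.+-identityʳ a)) (sym (mulS-oneʳ (prodS a F) n))
prodS-split F a (suc l) n = begin
  prodS (a ℕ.+ suc l) F n
    ≡⟨ cong (λ x → prodS x F n) (ℕP.+-suc a l) ⟩
  mulS (prodS (a ℕ.+ l) F) (F (a ℕ.+ l)) n
    ≡⟨ mulS-cong {g = F (a ℕ.+ l)} (prodS-split F a l) (λ _ → refl) n ⟩
  mulS (mulS (prodS a F) (prodS l (λ m → F (a ℕ.+ m)))) (F (a ℕ.+ l)) n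
    ≡⟨ mulS-assoc (prodS a F) (prodS l (λ m → F (a ℕ.+ m))) (F (a ℕ.+ l)) n ⟩
  mulS (prodS a F) (prodS (suc l) (λ m → F (a ℕ.+ m))) n ∎

tPow-diag : ∀ p → tPow p p ≡ 1ℤ
tPow-diag p with p ℕ.≟ p
... | yes _  = refl
... | no p≢p = ⊥-elim (p≢p refl)

tPow-off : ∀ {p n} → ¬ p ≡ n → tPow p n ≡ 0ℤ
tPow-off {p} {n} p≢n with p ℕ.≟ n
... | yes p≡n = ⊥-elim (p≢n p≡n)
... | no _    = refl

sum-tPow-outside : ∀ N p (u : ℕ → ℤ) → N ≤ p → sumℤ N (λ j → tPow p j * u j) ≡ 0ℤ
sum-tPow-outside N p u N≤p = sum-zero N (λ j j<N →
  trans (cong (_* u j) (tPow-off (λ p≡j → ℕP.<⇒≱ j<N (subst (N ≤_) p≡j N≤p)))) (ℤP.*-zeroˡ (u j)))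

sum-tPow-inside : ∀ N p (u : ℕ → ℤ) → p < N → sumℤ N (λ j → tPow p j * u j) ≡ u p
sum-tPow-inside (suc N) p u p<1+N with ℕP.m≤n⇒m<n∨m≡n (ℕP.≤-pred p<1+N)
... | inj₁ p<N = trans (cong₂ _+_ (sum-tPow-inside N p u p<N)
                                  (trans (cong (_* u N) (tPow-off (ℕP.<⇒≢ p<N))) (ℤP.*-zeroˡ (u N))))
                       (ℤP.+-identityʳ (u p))
... | inj₂ refl = begin
  sumℤ p (λ j → tPow p j * u j) + tPow p p * u p
    ≡⟨ cong₂ _+_ (sum-tPow-outside p p u ℕP.≤-refl) (cong (_* u p) (tPow-diag p)) ⟩
  0ℤ + 1ℤ * u p
    ≡⟨ trans (ℤP.+-identityˡ _) (ℤP.*-identityˡ (u p)) ⟩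
  u p ∎

tPow-mul-≥ : ∀ p f n → p ≤ n → mulS (tPow p) f n ≡ f (n ∸ p)
tPow-mul-≥ p f n p≤n = sum-tPow-inside (suc n) p (λ j → f (n ∸ j)) (s≤s p≤n)

tPow-mul-< : ∀ p f n → n < p → mulS (tPow p) f n ≡ 0ℤ
tPow-mul-< p f n n<p = sum-tPow-outside (suc n) p (λ j → f (n ∸ j)) n<p

tPow-shift-agree : ∀ q N {X X′} → AgreeUpTo N X X′ →
  AgreeUpTo (suc N) (mulS (tPow (suc q)) X) (mulS (tPow (suc q)) X′)
tPow-shift-agree q N {X} {X′} h m m≤1+N with suc q ℕ.≤? m
... | yes q<m = begin
  mulS (tPow (suc q)) X m    ≡⟨ tPow-mul-≥ (suc q) X m q<m ⟩
  X (m ∸ suc q)              ≡⟨ h (m ∸ suc q) (shifted q<m m≤1+N) ⟩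
  X′ (m ∸ suc q)             ≡⟨ sym (tPow-mul-≥ (suc q) X′ m q<m) ⟩
  mulS (tPow (suc q)) X′ m   ∎
  where
  shifted : ∀ {m} → suc q ≤ m → m ≤ suc N → m ∸ suc q ≤ N
  shifted (s≤s _) (s≤s m≤N) = ℕP.≤-trans (ℕP.m∸n≤m _ q) m≤N
... | no q≮m = trans (tPow-mul-< (suc q) X m (ℕP.≰⇒> q≮m)) (sym (tPow-mul-< (suc q) X′ m (ℕP.≰⇒> q≮m)))

powS-agree : ∀ N r {w w′} → AgreeUpTo N w w′ → AgreeUpTo N (powS w r) (powS w′ r)
powS-agree N zero    h m _ = refl
powS-agree N (suc r) h     = mulS-agree N (powS-agree N r h) h

geomInv-agree : ∀ N {w w′} → AgreeUpTo N w w′ → AgreeUpTo N (geomInv w) (geomInv w′)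
geomInv-agree N h m m≤N = sum-cong (suc m) (λ r _ → powS-agree N r h m m≤N)

powS-low : ∀ w → w 0 ≡ 0ℤ → ∀ r n → n < r → powS w r n ≡ 0ℤ
powS-low w w₀ (suc r) n n<1+r = sum-zero (suc n) term
  where
  term : ∀ j → j < suc n → powS w r j * w (n ∸ j) ≡ 0ℤ
  term j j<1+n with j ℕ.<? r
  ... | yes j<r = trans (cong (_* w (n ∸ j)) (powS-low w w₀ r j j<r)) (ℤP.*-zeroˡ (w (n ∸ j)))
  ... | no  j≮r = trans (cong (powS w r j *_) (trans (cong w (ℕP.m≤n⇒m∸n≡0 n≤j)) w₀)) (ℤP.*-zeroʳ (powS w r j))
    where
    n≤j : n ≤ j
    n≤j = ℕP.≤-trans (ℕP.≤-pred n<1+r) (ℕP.≮⇒≥ j≮r)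

geomInv-fix : ∀ w → w 0 ≡ 0ℤ → geomInv w ≈S addS oneS (mulS (geomInv w) w)
geomInv-fix w w₀ n = begin
  sumℤ (suc n) (λ r → powS w r n)
    ≡⟨ sym (ℤP.+-identityʳ _) ⟩
  sumℤ (suc n) (λ r → powS w r n) + 0ℤ
    ≡⟨ cong (_+_ (sumℤ (suc n) (λ r → powS w r n))) (sym (powS-low w w₀ (suc n) n (ℕP.n<1+n n))) ⟩
  sumℤ (suc (suc n)) (λ r → powS w r n)
    ≡⟨ sum-head (suc n) _ ⟩
  oneS n + sumℤ (suc n) (λ r → mulS (powS w r) w n)
    ≡⟨ cong (_+_ (oneS n)) (sym (sum-swap (suc n) (suc n) (λ j r → powS w r j * w (n ∸ j)))) ⟩
  oneS n + sumℤ (suc n) (λ j → sumℤ (suc n) (λ r → powS w r j * w (n ∸ j)))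
    ≡⟨ cong (_+_ (oneS n)) (sum-cong (suc n) truncate) ⟩
  oneS n + mulS (geomInv w) w n ∎
  where
  -- for fixed degree j only the powers r ≤ j contribute
  truncate : ∀ j → j < suc n →
    sumℤ (suc n) (λ r → powS w r j * w (n ∸ j)) ≡ geomInv w j * w (n ∸ j)
  truncate j j<1+n = begin
    sumℤ (suc n) (λ r → powS w r j * w (n ∸ j))
      ≡⟨ cong (λ x → sumℤ x (λ r → powS w r j * w (n ∸ j))) (sym range) ⟩
    sumℤ ((n ∸ j) ℕ.+ suc j) (λ r → powS w r j * w (n ∸ j))
      ≡⟨ sum-pad (suc j) (n ∸ j) (λ r j<r →
           trans (cong (_* w (n ∸ j)) (powS-low w w₀ r j j<r)) (ℤP.*-zeroˡ (w (n ∸ j)))) ⟩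
    sumℤ (suc j) (λ r → powS w r j * w (n ∸ j))
      ≡⟨ sym (sum-*ʳ (suc j) (w (n ∸ j)) (λ r → powS w r j)) ⟩
    geomInv w j * w (n ∸ j) ∎
    where
    range : (n ∸ j) ℕ.+ suc j ≡ suc n
    range = trans (ℕP.+-suc (n ∸ j) j) (cong suc (ℕP.m∸n+n≡m (ℕP.≤-pred j<1+n)))

wCoef : ℕ → ℕ → ℕ → ℤ
wCoef k i ℓ = + ((suc k C suc ℓ) ℕ.* prodℕ (suc ℓ) (λ m → i ℕ.+ m ℕ.+ 1))

wTerm : ℕ → (ℕ → FPS) → ℕ → ℕ → FPS
wTerm k G i ℓ = scaleS (wCoef k i ℓ) (mulS (tPow (suc ℓ)) (prodS ℓ (λ m → G (i ℕ.+ suc m))))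

-- The leading term (k+1)(i+1) t of w_i is the summand ℓ = 0.
wSeries-uniform : ∀ k G i → wSeries k G i ≈S sumS (suc k) (wTerm k G i)
wSeries-uniform k G i n = begin
  wSeries k G i n
    ≡⟨ cong₂ _+_ leading (sumS-coeff k (wTerm k G i ∘ suc) n) ⟩
  wTerm k G i 0 n + sumℤ k (λ ℓ → wTerm k G i (suc ℓ) n)
    ≡⟨ sym (sum-head k (λ ℓ → wTerm k G i ℓ n)) ⟩
  sumℤ (suc k) (λ ℓ → wTerm k G i ℓ n)
    ≡⟨ sym (sumS-coeff (suc k) (wTerm k G i) n) ⟩
  sumS (suc k) (wTerm k G i) n ∎
  where
  linear : ∀ i → suc i ≡ 1 ℕ.* (i ℕ.+ 0 ℕ.+ 1)
  linear = ℕSolver.solve-∀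
  leading : + (suc k ℕ.* suc i) * tPow 1 n ≡ wTerm k G i 0 n
  leading = cong₂ _*_ (cong +_ (cong₂ ℕ._*_ (sym (nC1≡n (suc k))) (linear i))) (sym (mulS-oneʳ (tPow 1) n))

wSeries-constant : ∀ k G i → wSeries k G i 0 ≡ 0ℤ
wSeries-constant k G i = trans (wSeries-uniform k G i 0) (trans (sumS-coeff (suc k) (wTerm k G i) 0)
  (sum-zero (suc k) (λ ℓ _ → trans (cong (wCoef k i ℓ *_) (tPow-mul-< (suc ℓ) (prodS ℓ (λ m → G (i ℕ.+ suc m))) 0 (s≤s z≤n)))
                                   (ℤP.*-zeroʳ (wCoef k i ℓ)))))

-- The recursion G_i = (1 - w_i)^{-1}: existence and uniqueness of solutions

Φ : ℕ → (ℕ → FPS) → ℕ → FPS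
Φ k G i = geomInv (wSeries k G i)

FamilyAgreeUpTo : ℕ → (ℕ → FPS) → (ℕ → FPS) → Set
FamilyAgreeUpTo N G G′ = ∀ i → AgreeUpTo N (G i) (G′ i)

-- Each G_j occurs in w_i multiplied by at least t^2, so w_i (and hence Φ) in
-- degrees ≤ N+1 only depends on the family in degrees ≤ N.
wSeries-agree : ∀ k N {G G′} → FamilyAgreeUpTo N G G′ → ∀ i →
  AgreeUpTo (suc N) (wSeries k G i) (wSeries k G′ i)
wSeries-agree k N {G} {G′} h i m m≤1+N =
  cong (_+_ (scaleS (+ (suc k ℕ.* suc i)) (tPow 1) m)) (sumS-agree (suc N) k termAgree m m≤1+N)
  where
  termAgree : ∀ j → AgreeUpTo (suc N) (wTerm k G i (suc j)) (wTerm k G′ i (suc j))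
  termAgree j m′ m′≤ = cong (wCoef k i (suc j) *_)
    (tPow-shift-agree (suc j) N (prodS-agree N (suc j) (λ m → h (i ℕ.+ suc m))) m′ m′≤)

Φ-agree : ∀ k N {G G′} → FamilyAgreeUpTo N G G′ → FamilyAgreeUpTo (suc N) (Φ k G) (Φ k G′)
Φ-agree k N h i = geomInv-agree (suc N) (wSeries-agree k N h i)

solutions-agree : ∀ k {G G′} → IsSolution k G → IsSolution k G′ → ∀ N → FamilyAgreeUpTo N G G′
solutions-agree k sG sG′ zero    i zero z≤n = trans (proj₁ (sG i)) (sym (proj₁ (sG′ i)))
solutions-agree k sG sG′ (suc N) i m m≤1+N =
  trans (proj₂ (sG i) m) (trans (Φ-agree k N (solutions-agree k sG sG′ N) i m m≤1+N) (sym (proj₂ (sG′ i) m)))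

-- Existence: iterate Φ from the constant family 1.  Consecutive iterates a and
-- a+1 agree in degrees ≤ a, hence so do all later ones, and the diagonal
-- limit k i n = [t^n] (a-th iterate with a = n) is a solution.
iterate : ℕ → ℕ → ℕ → FPS
iterate k zero    = λ _ → oneS
iterate k (suc a) = Φ k (iterate k a)

iterate-step : ∀ k a → FamilyAgreeUpTo a (iterate k a) (iterate k (suc a))
iterate-step k zero    i zero z≤n = refl
iterate-step k (suc a)            = Φ-agree k a (iterate-step k a)

iterate-stable : ∀ k a c → FamilyAgreeUpTo a (iterate k a) (iterate k (c ℕ.+ a))
iterate-stable k a zero    i m _   = refl
iterate-stable k a (suc c) i m m≤a =
  trans (iterate-stable k a c i m m≤a) (iterate-step k (c ℕ.+ a) i m (ℕP.≤-trans m≤a (ℕP.m≤n+m a c)))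

limit : ℕ → ℕ → FPS
limit k i n = iterate k n i n

limit-agree : ∀ k a → FamilyAgreeUpTo a (iterate k a) (limit k)
limit-agree k a i m m≤a = sym (trans (iterate-stable k m (a ∸ m) i m ℕP.≤-refl)
                                     (cong (λ x → iterate k x i m) (ℕP.m∸n+n≡m m≤a)))

limit-solves : ∀ k → IsSolution k (limit k)
limit-solves k i = refl , coeff
  where
  coeff : ∀ n → limit k i n ≡ Φ k (limit k) i n
  coeff zero    = refl
  coeff (suc n) = Φ-agree k n (limit-agree k n) i (suc n) ℕP.≤-refl

-- Binomial identities

pascal : ∀ n r → suc n C suc r ≡ n C r ℕ.+ n C suc r
pascal n r = sym (nCk+nC[k+1]≡[n+1]C[k+1] n r)

absorption : ∀ M s → suc s ℕ.* (suc M C suc s) ≡ suc M ℕ.* (M C s)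
absorption zero zero = refl
absorption zero (suc s) = begin
  suc (suc s) ℕ.* (1 C suc (suc s)) ≡⟨ cong (suc (suc s) ℕ.*_) (k>n⇒nCk≡0 {1} {suc (suc s)} (s≤s (s≤s z≤n))) ⟩
  suc (suc s) ℕ.* 0                 ≡⟨ ℕP.*-zeroʳ (suc (suc s)) ⟩
  0                                 ≡⟨ cong (1 ℕ.*_) (sym (k>n⇒nCk≡0 {0} {suc s} (s≤s z≤n))) ⟩
  1 ℕ.* (0 C suc s)                 ∎
absorption (suc M) zero = begin
  1 ℕ.* (suc (suc M) C 1) ≡⟨ ℕP.*-identityˡ _ ⟩
  suc (suc M) C 1         ≡⟨ nC1≡n (suc (suc M)) ⟩
  suc (suc M)             ≡⟨ sym (ℕP.*-identityʳ _) ⟩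
  suc (suc M) ℕ.* 1       ∎
absorption (suc M) (suc s) = begin
  suc (suc s) ℕ.* (suc (suc M) C suc (suc s))
    ≡⟨ cong (suc (suc s) ℕ.*_) (pascal (suc M) (suc s)) ⟩
  suc (suc s) ℕ.* (suc M C suc s ℕ.+ suc M C suc (suc s))
    ≡⟨ ℕP.*-distribˡ-+ (suc (suc s)) (suc M C suc s) (suc M C suc (suc s)) ⟩
  (suc M C suc s ℕ.+ suc s ℕ.* (suc M C suc s)) ℕ.+ suc (suc s) ℕ.* (suc M C suc (suc s))
    ≡⟨ cong₂ (λ a b → (suc M C suc s ℕ.+ a) ℕ.+ b) (absorption M s) (absorption M (suc s)) ⟩
  (suc M C suc s ℕ.+ suc M ℕ.* (M C s)) ℕ.+ suc M ℕ.* (M C suc s)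
    ≡⟨ ℕP.+-assoc (suc M C suc s) (suc M ℕ.* (M C s)) (suc M ℕ.* (M C suc s)) ⟩
  suc M C suc s ℕ.+ (suc M ℕ.* (M C s) ℕ.+ suc M ℕ.* (M C suc s))
    ≡⟨ cong (suc M C suc s ℕ.+_) (sym (ℕP.*-distribˡ-+ (suc M) (M C s) (M C suc s))) ⟩
  suc M C suc s ℕ.+ suc M ℕ.* (M C s ℕ.+ M C suc s)
    ≡⟨ cong (λ x → suc M C suc s ℕ.+ suc M ℕ.* x) (sym (pascal M s)) ⟩
  suc (suc M) ℕ.* (suc M C suc s) ∎

-- The binomial shift  (Sh r u) j = Σ_{d ≤ r} C(r,d) u(d+j),  i.e. (1 + E)^r u
-- for the shift operator E.
Sh : ℕ → (ℕ → ℤ) → ℕ → ℤ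
Sh r u j = sumℤ (suc r) (λ d → + (r C d) * u (d ℕ.+ j))

Sh-zero : ∀ u j → Sh 0 u j ≡ u j
Sh-zero u j = trans (ℤP.+-identityˡ _) (ℤP.*-identityˡ _)

Sh-suc : ∀ r u j → Sh (suc r) u j ≡ Sh r u j + Sh r (u ∘ suc) j
Sh-suc r u j = begin
  Sh (suc r) u j
    ≡⟨ sum-head (suc r) _ ⟩
  1ℤ * u j + sumℤ (suc r) (λ d → + (suc r C suc d) * u (suc d ℕ.+ j))
    ≡⟨ cong (_+_ (1ℤ * u j)) (trans (sum-cong′ (suc r) splitTerm) (sum-+ (suc r) _ _)) ⟩
  1ℤ * u j + (Sh r (u ∘ suc) j + Upper)
    ≡⟨ rearrange (1ℤ * u j) (Sh r (u ∘ suc) j) Upper ⟩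
  (1ℤ * u j + Upper) + Sh r (u ∘ suc) j
    ≡⟨ cong (_+ Sh r (u ∘ suc) j) (sym (sum-head (suc r) (λ d → + (r C d) * u (d ℕ.+ j)))) ⟩
  (Sh r u j + + (r C suc r) * u (suc r ℕ.+ j)) + Sh r (u ∘ suc) j
    ≡⟨ cong (λ x → (Sh r u j + + x * u (suc r ℕ.+ j)) + Sh r (u ∘ suc) j) (k>n⇒nCk≡0 (ℕP.n<1+n r)) ⟩
  (Sh r u j + 0ℤ) + Sh r (u ∘ suc) j
    ≡⟨ cong (_+ Sh r (u ∘ suc) j) (ℤP.+-identityʳ (Sh r u j)) ⟩
  Sh r u j + Sh r (u ∘ suc) j ∎
  where
  Upper : ℤ
  Upper = sumℤ (suc r) (λ d → + (r C suc d) * u (suc d ℕ.+ j))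
  splitTerm : ∀ d → + (suc r C suc d) * u (suc d ℕ.+ j)
                  ≡ + (r C d) * u (suc d ℕ.+ j) + + (r C suc d) * u (suc d ℕ.+ j)
  splitTerm d = trans (cong (λ x → + x * u (suc d ℕ.+ j)) (pascal r d))
                (trans (cong (_* u (suc d ℕ.+ j)) (ℤP.pos-+ (r C d) (r C suc d)))
                       (ℤP.*-distribʳ-+ (u (suc d ℕ.+ j)) (+ (r C d)) (+ (r C suc d))))
  rearrange : ∀ a b c → a + (b + c) ≡ (a + c) + b
  rearrange = solve-∀

pascal-adjoint : ∀ M B (u : ℕ → ℤ) → u B ≡ 0ℤ →
  sumℤ B (λ s → + (M C s) * u s) + sumℤ B (λ s → + (M C s) * u (suc s))
    ≡ sumℤ B (λ s → + (suc M C s) * u s)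
pascal-adjoint M zero    u uB = refl
pascal-adjoint M (suc B) u uB = begin
  sumℤ (suc B) (λ s → + (M C s) * u s) + (Lower + + (M C B) * u (suc B))
    ≡⟨ cong₂ _+_ (sum-head B _) (cong (_+_ Lower) (trans (cong (+ (M C B) *_) uB) (ℤP.*-zeroʳ (+ (M C B))))) ⟩
  (1ℤ * u 0 + Upper) + (Lower + 0ℤ)
    ≡⟨ rearrange (1ℤ * u 0) Upper Lower ⟩
  1ℤ * u 0 + (Lower + Upper)
    ≡⟨ cong (_+_ (1ℤ * u 0)) (trans (sym (sum-+ B _ _)) (sum-cong′ B mergeTerm)) ⟩
  1ℤ * u 0 + sumℤ B (λ s → + (suc M C suc s) * u (suc s))
    ≡⟨ sym (sum-head B _) ⟩
  sumℤ (suc B) (λ s → + (suc M C s) * u s) ∎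
  where
  Lower Upper : ℤ
  Lower = sumℤ B (λ s → + (M C s) * u (suc s))
  Upper = sumℤ B (λ s → + (M C suc s) * u (suc s))
  mergeTerm : ∀ s → + (M C s) * u (suc s) + + (M C suc s) * u (suc s) ≡ + (suc M C suc s) * u (suc s)
  mergeTerm s = trans (sym (ℤP.*-distribʳ-+ (u (suc s)) (+ (M C s)) (+ (M C suc s))))
                      (cong (_* u (suc s)) (trans (sym (ℤP.pos-+ (M C s) (M C suc s))) (cong +_ (sym (pascal M s)))))
  rearrange : ∀ a b c → (a + b) + (c + 0ℤ) ≡ a + (c + b)
  rearrange = solve-∀

vandermonde : ∀ r m B (u : ℕ → ℤ) → (∀ s → B ≤ s → u s ≡ 0ℤ) →
  sumℤ B (λ j → + (m C j) * Sh r u j) ≡ sumℤ B (λ s → + ((m ℕ.+ r) C s) * u s)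
vandermonde zero m B u u≥B =
  sum-cong′ B (λ j → cong₂ (λ a b → + (a C j) * b) (sym (ℕP.+-identityʳ m)) (Sh-zero u j))
vandermonde (suc r) m B u u≥B = begin
  sumℤ B (λ j → + (m C j) * Sh (suc r) u j)
    ≡⟨ trans (sum-cong′ B (λ j → trans (cong (+ (m C j) *_) (Sh-suc r u j)) (ℤP.*-distribˡ-+ (+ (m C j)) _ _)))
             (sum-+ B _ _) ⟩
  sumℤ B (λ j → + (m C j) * Sh r u j) + sumℤ B (λ j → + (m C j) * Sh r (u ∘ suc) j)
    ≡⟨ cong₂ _+_ (vandermonde r m B u u≥B) (vandermonde r m B (u ∘ suc) (λ s B≤s → u≥B (suc s) (ℕP.m≤n⇒m≤1+n B≤s))) ⟩
  sumℤ B (λ s → + ((m ℕ.+ r) C s) * u s) + sumℤ B (λ s → + ((m ℕ.+ r) C s) * u (suc s))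
    ≡⟨ pascal-adjoint (m ℕ.+ r) B u (u≥B B ℕP.≤-refl) ⟩
  sumℤ B (λ s → + (suc (m ℕ.+ r) C s) * u s)
    ≡⟨ sum-cong′ B (λ s → cong (λ x → + (x C s) * u s) (sym (ℕP.+-suc m r))) ⟩
  sumℤ B (λ s → + ((m ℕ.+ suc r) C s) * u s) ∎

-- The table T and its binomial transform

-- T k N j will turn out to be  j! [t^{N-j}] (G_0 ⋯ G_j);  it is defined by
--   T(0, j) = [j = 0],   T(N+1, j) = Σ_{d ≤ k+1} C(k+1,d) (d+j) T(N, d+j-1).
T : ℕ → ℕ → ℕ → ℤ
T k zero    zero    = 1ℤ
T k zero    (suc j) = 0ℤ
T k (suc N) j       = Sh (suc k) (λ s → + s * T k N (pred s)) j

table-support : ∀ k N j → N < j → T k N j ≡ 0ℤ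
table-support k zero    (suc j) _   = refl
table-support k (suc N) j       N<j = sum-zero (suc (suc k)) (λ d _ → term d)
  where
  term : ∀ d → + (suc k C d) * (+ (d ℕ.+ j) * T k N (pred (d ℕ.+ j))) ≡ 0ℤ
  term d = begin
    + (suc k C d) * (+ (d ℕ.+ j) * T k N (pred (d ℕ.+ j)))
      ≡⟨ cong (λ x → + (suc k C d) * (+ (d ℕ.+ j) * x)) (table-support k N (pred (d ℕ.+ j)) bound) ⟩
    + (suc k C d) * (+ (d ℕ.+ j) * 0ℤ)
      ≡⟨ trans (cong (+ (suc k C d) *_) (ℤP.*-zeroʳ (+ (d ℕ.+ j)))) (ℤP.*-zeroʳ (+ (suc k C d))) ⟩
    0ℤ ∎
    where
    bound : N < pred (d ℕ.+ j)
    bound = ℕP.≤-trans (ℕP.pred-mono-≤ N<j) (ℕP.pred-mono-≤ (ℕP.m≤n+m j d))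

table-step : ∀ k M i → T k (suc M) i ≡
  + i * T k M (pred i) + sumℤ (suc k) (λ ℓ → + (suc k C suc ℓ) * (+ suc (ℓ ℕ.+ i) * T k M (ℓ ℕ.+ i)))
table-step k M i = trans (sum-head (suc k) _)
  (cong (_+ sumℤ (suc k) (λ ℓ → + (suc k C suc ℓ) * (+ suc (ℓ ℕ.+ i) * T k M (ℓ ℕ.+ i))))
        (ℤP.*-identityˡ (+ i * T k M (pred i))))

binomialTransform : ℕ → ℕ → ℕ → ℤ
binomialTransform k n m = sumℤ (suc n) (λ j → + (m C j) * T k n j)

-- Vandermonde and absorption turn the recursion of T into
--   W(n+1, m) = (m+k+1) W(n, m+k).
transform-step : ∀ k n m →
  binomialTransform k (suc n) m ≡ + suc (m ℕ.+ k) * binomialTransform k n (m ℕ.+ k)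
transform-step k n m = begin
  sumℤ (suc (suc n)) (λ j → + (m C j) * Sh (suc k) u j)
    ≡⟨ vandermonde (suc k) m (suc (suc n)) u u-support ⟩
  sumℤ (suc (suc n)) (λ s → + ((m ℕ.+ suc k) C s) * u s)
    ≡⟨ sum-head (suc n) _ ⟩
  + ((m ℕ.+ suc k) C 0) * 0ℤ + sumℤ (suc n) (λ s → + ((m ℕ.+ suc k) C suc s) * u (suc s))
    ≡⟨ cong₂ _+_ (ℤP.*-zeroʳ (+ ((m ℕ.+ suc k) C 0))) (sum-cong′ (suc n) absorbTerm) ⟩
  0ℤ + sumℤ (suc n) (λ s → + suc (m ℕ.+ k) * (+ ((m ℕ.+ k) C s) * T k n s))
    ≡⟨ trans (ℤP.+-identityˡ _) (sym (sum-*ˡ (suc n) (+ suc (m ℕ.+ k)) _)) ⟩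
  + suc (m ℕ.+ k) * binomialTransform k n (m ℕ.+ k) ∎
  where
  u : ℕ → ℤ
  u s = + s * T k n (pred s)
  u-support : ∀ s → suc (suc n) ≤ s → u s ≡ 0ℤ
  u-support s n+2≤s = trans (cong (+ s *_) (table-support k n (pred s) (ℕP.pred-mono-≤ n+2≤s))) (ℤP.*-zeroʳ (+ s))
  absorbTerm : ∀ s → + ((m ℕ.+ suc k) C suc s) * (+ suc s * T k n s)
                   ≡ + suc (m ℕ.+ k) * (+ ((m ℕ.+ k) C s) * T k n s)
  absorbTerm s = begin
    + ((m ℕ.+ suc k) C suc s) * (+ suc s * T k n s)
      ≡⟨ sym (ℤP.*-assoc (+ ((m ℕ.+ suc k) C suc s)) (+ suc s) (T k n s)) ⟩
    + ((m ℕ.+ suc k) C suc s) * + suc s * T k n s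
      ≡⟨ cong (_* T k n s) (sym (ℤP.pos-* ((m ℕ.+ suc k) C suc s) (suc s))) ⟩
    + (((m ℕ.+ suc k) C suc s) ℕ.* suc s) * T k n s
      ≡⟨ cong (λ x → + x * T k n s) naturalIdentity ⟩
    + (suc (m ℕ.+ k) ℕ.* ((m ℕ.+ k) C s)) * T k n s
      ≡⟨ cong (_* T k n s) (ℤP.pos-* (suc (m ℕ.+ k)) ((m ℕ.+ k) C s)) ⟩
    + suc (m ℕ.+ k) * + ((m ℕ.+ k) C s) * T k n s
      ≡⟨ ℤP.*-assoc (+ suc (m ℕ.+ k)) (+ ((m ℕ.+ k) C s)) (T k n s) ⟩
    + suc (m ℕ.+ k) * (+ ((m ℕ.+ k) C s) * T k n s) ∎
    where
    naturalIdentity : ((m ℕ.+ suc k) C suc s) ℕ.* suc s ≡ suc (m ℕ.+ k) ℕ.* ((m ℕ.+ k) C s)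
    naturalIdentity = begin
      ((m ℕ.+ suc k) C suc s) ℕ.* suc s ≡⟨ ℕP.*-comm ((m ℕ.+ suc k) C suc s) (suc s) ⟩
      suc s ℕ.* ((m ℕ.+ suc k) C suc s) ≡⟨ cong (λ x → suc s ℕ.* (x C suc s)) (ℕP.+-suc m k) ⟩
      suc s ℕ.* (suc (m ℕ.+ k) C suc s) ≡⟨ absorption (m ℕ.+ k) s ⟩
      suc (m ℕ.+ k) ℕ.* ((m ℕ.+ k) C s) ∎

prodℕ-head : ∀ n (f : ℕ → ℕ) → prodℕ (suc n) f ≡ f 0 ℕ.* prodℕ n (f ∘ suc)
prodℕ-head zero    f = trans (ℕP.*-identityˡ (f 0)) (sym (ℕP.*-identityʳ (f 0)))
prodℕ-head (suc n) f = trans (cong (ℕ._* f (suc n)) (prodℕ-head n f)) (ℕP.*-assoc (f 0) _ (f (suc n)))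

prodℕ-cong : ∀ n {f g : ℕ → ℕ} → (∀ r → f r ≡ g r) → prodℕ n f ≡ prodℕ n g
prodℕ-cong zero    e = refl
prodℕ-cong (suc n) e = cong₂ ℕ._*_ (prodℕ-cong n e) (e n)

transform-closed : ∀ k n m → binomialTransform k n m ≡ + prodℕ n (λ r → m ℕ.+ (k ℕ.* suc r ℕ.+ 1))
transform-closed k zero    m = refl
transform-closed k (suc n) m = begin
  binomialTransform k (suc n) m
    ≡⟨ transform-step k n m ⟩
  + suc (m ℕ.+ k) * binomialTransform k n (m ℕ.+ k)
    ≡⟨ cong (+ suc (m ℕ.+ k) *_) (transform-closed k n (m ℕ.+ k)) ⟩
  + suc (m ℕ.+ k) * + prodℕ n (λ r → (m ℕ.+ k) ℕ.+ (k ℕ.* suc r ℕ.+ 1))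
    ≡⟨ sym (ℤP.pos-* (suc (m ℕ.+ k)) _) ⟩
  + (suc (m ℕ.+ k) ℕ.* prodℕ n (λ r → (m ℕ.+ k) ℕ.+ (k ℕ.* suc r ℕ.+ 1)))
    ≡⟨ cong +_ (sym (trans (prodℕ-head n _) (cong₂ ℕ._*_ (firstFactor m k) (prodℕ-cong n (laterFactor m k))))) ⟩
  + prodℕ (suc n) (λ r → m ℕ.+ (k ℕ.* suc r ℕ.+ 1)) ∎
  where
  firstFactor : ∀ m k → m ℕ.+ (k ℕ.* 1 ℕ.+ 1) ≡ suc (m ℕ.+ k)
  firstFactor = ℕSolver.solve-∀
  laterFactor : ∀ m k r → m ℕ.+ (k ℕ.* suc (suc r) ℕ.+ 1) ≡ (m ℕ.+ k) ℕ.+ (k ℕ.* suc r ℕ.+ 1)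
  laterFactor = ℕSolver.solve-∀

column-zero : ∀ k n → T k n 0 ≡ + kStirling k n
column-zero k n = begin
  T k n 0                   ≡⟨ sym onlyFirst ⟩
  binomialTransform k n 0   ≡⟨ transform-closed k n 0 ⟩
  + kStirling k n           ∎
  where
  onlyFirst : binomialTransform k n 0 ≡ T k n 0
  onlyFirst = trans (sum-head n _)
    (trans (cong₂ _+_ (ℤP.*-identityˡ (T k n 0)) (sum-zero n (λ j _ → ℤP.*-zeroˡ (T k n (suc j)))))
           (ℤP.+-identityʳ _))

factorial-prod : ∀ i l → i ! ℕ.* prodℕ l (λ m → i ℕ.+ m ℕ.+ 1) ≡ (l ℕ.+ i) !
factorial-prod i zero    = ℕP.*-identityʳ (i !)
factorial-prod i (suc l) = begin
  i ! ℕ.* (prodℕ l f ℕ.* (i ℕ.+ l ℕ.+ 1))  ≡⟨ sym (ℕP.*-assoc (i !) (prodℕ l f) (i ℕ.+ l ℕ.+ 1)) ⟩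
  i ! ℕ.* prodℕ l f ℕ.* (i ℕ.+ l ℕ.+ 1)    ≡⟨ cong₂ ℕ._*_ (factorial-prod i l) (topFactor i l) ⟩
  (l ℕ.+ i) ! ℕ.* suc (l ℕ.+ i)            ≡⟨ ℕP.*-comm ((l ℕ.+ i) !) (suc (l ℕ.+ i)) ⟩
  suc (l ℕ.+ i) !                          ∎
  where
  f : ℕ → ℕ
  f m = i ℕ.+ m ℕ.+ 1
  topFactor : ∀ i l → i ℕ.+ l ℕ.+ 1 ≡ suc (l ℕ.+ i)
  topFactor = ℕSolver.solve-∀

factorial-weight : ∀ k i ℓ x → + (i !) * (wCoef k i ℓ * x)
  ≡ + (suc k C suc ℓ) * (+ suc (ℓ ℕ.+ i) * (+ ((ℓ ℕ.+ i) !) * x))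
factorial-weight k i ℓ x = begin
  + (i !) * (+ (c ℕ.* p) * x)
    ≡⟨ cong (λ y → + (i !) * (y * x)) (ℤP.pos-* c p) ⟩
  + (i !) * (+ c * + p * x)
    ≡⟨ regroup (+ (i !)) (+ c) (+ p) x ⟩
  + c * (+ (i !) * + p * x)
    ≡⟨ cong (λ y → + c * (y * x)) (sym (ℤP.pos-* (i !) p)) ⟩
  + c * (+ (i ! ℕ.* p) * x)
    ≡⟨ cong (λ y → + c * (+ y * x)) (factorial-prod i (suc ℓ)) ⟩
  + c * (+ (suc (ℓ ℕ.+ i) ℕ.* (ℓ ℕ.+ i) !) * x)
    ≡⟨ cong (λ y → + c * (y * x)) (ℤP.pos-* (suc (ℓ ℕ.+ i)) ((ℓ ℕ.+ i) !)) ⟩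
  + c * (+ suc (ℓ ℕ.+ i) * + ((ℓ ℕ.+ i) !) * x)
    ≡⟨ cong (+ c *_) (ℤP.*-assoc (+ suc (ℓ ℕ.+ i)) (+ ((ℓ ℕ.+ i) !)) x) ⟩
  + c * (+ suc (ℓ ℕ.+ i) * (+ ((ℓ ℕ.+ i) !) * x)) ∎
  where
  c p : ℕ
  c = suc k C suc ℓ
  p = prodℕ (suc ℓ) (λ m → i ℕ.+ m ℕ.+ 1)
  regroup : ∀ a c p x → a * (c * p * x) ≡ c * (a * p * x)
  regroup = solve-∀

-- The coefficients of the products P_i = G_0 ⋯ G_{i-1} of a solution

module Solution (k : ℕ) (G : ℕ → FPS) (sol : IsSolution k G) where

  P : ℕ → FPS
  P i = prodS i G

  -- G_i = 1 + G_i w_i, because w_i has no constant term.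
  G-fix : ∀ i → G i ≈S addS oneS (mulS (G i) (wSeries k G i))
  G-fix i n = begin
    G i n                          ≡⟨ proj₂ (sol i) n ⟩
    geomInv w n                    ≡⟨ geomInv-fix w (wSeries-constant k G i) n ⟩
    oneS n + mulS (geomInv w) w n  ≡⟨ cong (_+_ (oneS n)) (mulS-cong {g = w} (λ m → sym (proj₂ (sol i) m)) (λ _ → refl) n) ⟩
    oneS n + mulS (G i) w n        ∎
    where
    w : FPS
    w = wSeries k G i

  P-fix : ∀ i → P (suc i) ≈S addS (P i) (mulS (P (suc i)) (wSeries k G i))
  P-fix i n = begin
    mulS (P i) (G i) n                                 ≡⟨ mulS-cong {f = P i} (λ _ → refl) (G-fix i) n ⟩
    mulS (P i) (addS oneS (mulS (G i) w)) n            ≡⟨ mulS-addʳ (P i) oneS (mulS (G i) w) n ⟩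
    mulS (P i) oneS n + mulS (P i) (mulS (G i) w) n    ≡⟨ cong₂ _+_ (mulS-oneʳ (P i) n) (sym (mulS-assoc (P i) (G i) w n)) ⟩
    P i n + mulS (P (suc i)) w n                       ∎
    where
    w : FPS
    w = wSeries k G i

  P-absorb : ∀ i ℓ → mulS (prodS ℓ (λ m → G (i ℕ.+ suc m))) (P (suc i)) ≈S P (suc (ℓ ℕ.+ i))
  P-absorb i ℓ n = begin
    mulS Q (P (suc i)) n
      ≡⟨ mulS-comm Q (P (suc i)) n ⟩
    mulS (P (suc i)) Q n
      ≡⟨ mulS-cong {f = P (suc i)} (λ _ → refl) (prodS-cong ℓ (λ m n′ → cong (λ x → G x n′) (ℕP.+-suc i m))) n ⟩
    mulS (P (suc i)) (prodS ℓ (λ m → G (suc i ℕ.+ m))) n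
      ≡⟨ sym (prodS-split G (suc i) ℓ n) ⟩
    P (suc i ℕ.+ ℓ) n
      ≡⟨ cong (λ x → P (suc x) n) (ℕP.+-comm i ℓ) ⟩
    P (suc (ℓ ℕ.+ i)) n ∎
    where
    Q : FPS
    Q = prodS ℓ (λ m → G (i ℕ.+ suc m))

  P-times-w : ∀ i → mulS (P (suc i)) (wSeries k G i)
    ≈S sumS (suc k) (λ ℓ → scaleS (wCoef k i ℓ) (mulS (tPow (suc ℓ)) (P (suc (ℓ ℕ.+ i)))))
  P-times-w i n = begin
    mulS (P (suc i)) (wSeries k G i) n                          ≡⟨ mulS-comm (P (suc i)) (wSeries k G i) n ⟩
    mulS (wSeries k G i) (P (suc i)) n                          ≡⟨ mulS-cong {g = P (suc i)} (wSeries-uniform k G i) (λ _ → refl) n ⟩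
    mulS (sumS (suc k) (wTerm k G i)) (P (suc i)) n             ≡⟨ mulS-sumˡ (suc k) (wTerm k G i) (P (suc i)) n ⟩
    sumS (suc k) (λ ℓ → mulS (wTerm k G i ℓ) (P (suc i))) n     ≡⟨ sumS-cong (suc k) summand n ⟩
    sumS (suc k) (λ ℓ → scaleS (wCoef k i ℓ) (mulS (tPow (suc ℓ)) (P (suc (ℓ ℕ.+ i))))) n ∎
    where
    summand : ∀ ℓ → mulS (wTerm k G i ℓ) (P (suc i))
      ≈S scaleS (wCoef k i ℓ) (mulS (tPow (suc ℓ)) (P (suc (ℓ ℕ.+ i))))
    summand ℓ m = begin
      mulS (scaleS c (mulS t Q)) (P (suc i)) m  ≡⟨ mulS-scaleˡ c (mulS t Q) (P (suc i)) m ⟩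
      c * mulS (mulS t Q) (P (suc i)) m         ≡⟨ cong (c *_) (mulS-assoc t Q (P (suc i)) m) ⟩
      c * mulS t (mulS Q (P (suc i))) m         ≡⟨ cong (c *_) (mulS-cong {f = t} (λ _ → refl) (P-absorb i ℓ) m) ⟩
      c * mulS t (P (suc (ℓ ℕ.+ i))) m          ∎
      where
      c : ℤ
      c = wCoef k i ℓ
      t Q : FPS
      t = tPow (suc ℓ)
      Q = prodS ℓ (λ m → G (i ℕ.+ suc m))

  -- [t^n] t^{ℓ+1} a_j, where a_j = j! P_{j+1}.
  shiftedA : ℕ → ℕ → ℕ → ℤ
  shiftedA ℓ j n = + (j !) * mulS (tPow (suc ℓ)) (P (suc j)) n

  P-rec : ∀ i n → + (i !) * P (suc i) n ≡ + (i !) * P i n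
    + sumℤ (suc k) (λ ℓ → + (suc k C suc ℓ) * (+ suc (ℓ ℕ.+ i) * shiftedA ℓ (ℓ ℕ.+ i) n))
  P-rec i n = begin
    + (i !) * P (suc i) n
      ≡⟨ cong (+ (i !) *_) (P-fix i n) ⟩
    + (i !) * (P i n + mulS (P (suc i)) (wSeries k G i) n)
      ≡⟨ ℤP.*-distribˡ-+ (+ (i !)) (P i n) _ ⟩
    + (i !) * P i n + + (i !) * mulS (P (suc i)) (wSeries k G i) n
      ≡⟨ cong (_+_ (+ (i !) * P i n)) (cong (+ (i !) *_) (trans (P-times-w i n) (sumS-coeff (suc k) _ n))) ⟩
    + (i !) * P i n + + (i !) * sumℤ (suc k) (λ ℓ → wCoef k i ℓ * mulS (tPow (suc ℓ)) (P (suc (ℓ ℕ.+ i))) n)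
      ≡⟨ cong (_+_ (+ (i !) * P i n))
           (trans (sum-*ˡ (suc k) (+ (i !)) _) (sum-cong′ (suc k) (λ ℓ → factorial-weight k i ℓ _))) ⟩
    + (i !) * P i n
      + sumℤ (suc k) (λ ℓ → + (suc k C suc ℓ) * (+ suc (ℓ ℕ.+ i) * shiftedA ℓ (ℓ ℕ.+ i) n)) ∎

  RowCorrect : ℕ → Set
  RowCorrect M = ∀ j n → n ℕ.+ j ≡ M → + (j !) * P (suc j) n ≡ T k M j

  -- The term i! P_i = i a_{i-1} (or P_0 = 1 when i = 0, which is 0 in positive degree).
  lower-term : ∀ {M} → RowCorrect M → ∀ i n → n ℕ.+ i ≡ suc M → + (i !) * P i n ≡ + i * T k M (pred i)
  lower-term     row zero    zero    ()
  lower-term {M} row zero    (suc n) _ = sym (ℤP.*-zeroˡ (T k M 0))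
  lower-term {M} row (suc i) n       e = begin
    + (suc i ℕ.* i !) * P (suc i) n   ≡⟨ cong (_* P (suc i) n) (ℤP.pos-* (suc i) (i !)) ⟩
    + suc i * + (i !) * P (suc i) n   ≡⟨ ℤP.*-assoc (+ suc i) (+ (i !)) (P (suc i) n) ⟩
    + suc i * (+ (i !) * P (suc i) n) ≡⟨ cong (+ suc i *_) (row i n (ℕP.suc-injective (trans (sym (ℕP.+-suc n i)) e))) ⟩
    + suc i * T k M i                 ∎

  -- The shifted terms t^{ℓ+1} a_{ℓ+i}; in low degree both sides vanish.
  shifted-term : ∀ {M} → RowCorrect M → ∀ i n ℓ → n ℕ.+ i ≡ suc M → shiftedA ℓ (ℓ ℕ.+ i) n ≡ T k M (ℓ ℕ.+ i)
  shifted-term {M} row i n ℓ e with suc ℓ ℕ.≤? n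
  ... | yes ℓ<n = trans (cong (+ ((ℓ ℕ.+ i) !) *_) (tPow-mul-≥ (suc ℓ) (P (suc (ℓ ℕ.+ i))) n ℓ<n))
                        (row (ℓ ℕ.+ i) (n ∸ suc ℓ) degree)
    where
    regroup : ∀ a ℓ i → a ℕ.+ suc ℓ ℕ.+ i ≡ suc (a ℕ.+ (ℓ ℕ.+ i))
    regroup = ℕSolver.solve-∀
    degree : n ∸ suc ℓ ℕ.+ (ℓ ℕ.+ i) ≡ M
    degree = ℕP.suc-injective (trans (sym (regroup (n ∸ suc ℓ) ℓ i)) (trans (cong (ℕ._+ i) (ℕP.m∸n+n≡m ℓ<n)) e))
  ... | no ℓ≮n = begin
    shiftedA ℓ (ℓ ℕ.+ i) n
      ≡⟨ cong (+ ((ℓ ℕ.+ i) !) *_) (tPow-mul-< (suc ℓ) (P (suc (ℓ ℕ.+ i))) n (ℕP.≰⇒> ℓ≮n)) ⟩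
    + ((ℓ ℕ.+ i) !) * 0ℤ
      ≡⟨ ℤP.*-zeroʳ (+ ((ℓ ℕ.+ i) !)) ⟩
    0ℤ
      ≡⟨ sym (table-support k M (ℓ ℕ.+ i) beyond) ⟩
    T k M (ℓ ℕ.+ i) ∎
    where
    beyond : M < ℓ ℕ.+ i
    beyond = subst (_≤ ℓ ℕ.+ i) e (ℕP.+-monoˡ-≤ i (ℕP.≤-pred (ℕP.≰⇒> ℓ≮n)))

  coefficients : ∀ M → RowCorrect M
  coefficients zero    j zero    refl = trans (ℤP.*-identityˡ _) (trans (mulS-oneˡ (G 0) 0) (proj₁ (sol 0)))
  coefficients zero    j (suc n) ()
  coefficients (suc M) i n       e    = begin
    + (i !) * P (suc i) n
      ≡⟨ P-rec i n ⟩
    + (i !) * P i n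
      + sumℤ (suc k) (λ ℓ → + (suc k C suc ℓ) * (+ suc (ℓ ℕ.+ i) * shiftedA ℓ (ℓ ℕ.+ i) n))
      ≡⟨ cong₂ _+_ (lower-term (coefficients M) i n e)
                   (sum-cong′ (suc k) (λ ℓ → cong (λ x → + (suc k C suc ℓ) * (+ suc (ℓ ℕ.+ i) * x))
                                                  (shifted-term (coefficients M) i n ℓ e))) ⟩
    + i * T k M (pred i) + sumℤ (suc k) (λ ℓ → + (suc k C suc ℓ) * (+ suc (ℓ ℕ.+ i) * T k M (ℓ ℕ.+ i)))
      ≡⟨ sym (table-step k M i) ⟩
    T k (suc M) i ∎

  -- G_0 = P_1 = 0! P_1, whose n-th coefficient is T(n, 0).
  G₀-coefficients : ∀ n → G 0 n ≡ + kStirling k n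
  G₀-coefficients n = begin
    G 0 n            ≡⟨ sym (mulS-oneˡ (G 0) n) ⟩
    P 1 n            ≡⟨ sym (ℤP.*-identityˡ (P 1 n)) ⟩
    + (0 !) * P 1 n  ≡⟨ coefficients n 0 n (ℕP.+-identityʳ n) ⟩
    T k n 0          ≡⟨ column-zero k n ⟩
    + kStirling k n  ∎

corollary1 : (k : ℕ) → 1 ≤ k →
    Σ (ℕ → FPS) (IsSolution k)
    × ((G G′ : ℕ → FPS) → IsSolution k G → IsSolution k G′ → (i n : ℕ) → G i n ≡ G′ i n)
    × ((G : ℕ → FPS) → IsSolution k G → (n : ℕ) → G 0 n ≡ + (kStirling k n))
corollary1 k _ =
  (limit k , limit-solves k) ,
  (λ G G′ sG sG′ i n → solutions-agree k sG sG′ n i n ℕP.≤-refl) ,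
  (λ G sG → Solution.G₀-coefficients k G sG)
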